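{- Let $1\le r\le z$ be integers and let $B[1..r]$ be a monotonically nondecreasing sequence of integers with $i\le B[i]$ for all $i\le r$ and $B[r]=z$. For $1\le i\le r$, let $I_i=[i,B[i]]$ be an integer interval of length $\ell_i=B[i]-i+1$. For each position $j\in\{1,\dots,z\}$, let $a(j)$ be the largest index $i$ such that $I_i$ covers $j$ (i.e. $i\le j\le B[i]$) and $\ell_i$ is minimum among the lengths of all intervals covering $j$. For $1\le i\le r$, define $$t_i=\max\Big\{\,i,\ \max\{B[h]+1 : h<i,\ \ell_h<\ell_i\}\Big\}$$ (the inner maximum over an empty set is ignored). For $1\le m\le z$, let $t_m^{ -1}=\{\,j\in\{1,\dots,r\} : t_j=m\,\}$. Then for every $i\in\{1,\dots,z\}$: $$a(i)=\max\bigcup_{m=1}^{i} t_m^{ -1}.$$ Consequently, for every $2\le i\le z$: $$a(i)=\max\{\,a(i-1),\ \max t_i^{ -1}\,\},$$ where $\max t_i^{ -1}$ is omitted when $t_i^{ -1}$ is empty. -}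

module Defs where

open import Data.Nat using (ℕ; suc; _+_; _∸_; _≤_; _<_; _<?_; _⊔_)
open import Data.List using (List; map; filter; foldr; upTo)
open import Data.Product using (_×_; ∃-syntax)
open import Relation.Binary.PropositionalEquality using (_≡_)

-- The sequence B[1..r] is modelled as a function ℕ → ℕ; only its values
-- at 1..r matter (all hypotheses/definitions only inspect those).

ℓ : (ℕ → ℕ) → ℕ → ℕ
ℓ B i = suc (B i) ∸ i

below : ℕ → List ℕ
below i = map suc (upTo (i ∸ 1))

-- t_i = max { i , max { B[h]+1 : 1 ≤ h < i , ℓ_h < ℓ_i } }
-- (empty inner max ignored: folding with 0 is harmless since i ≥ 1)
t : (ℕ → ℕ) → ℕ → ℕ
t B i = i ⊔ foldr _⊔_ 0 (map (λ h → B h + 1) (filter (λ h → ℓ B h <? ℓ B i) (below i)))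

IsMax : (ℕ → Set) → ℕ → Set
IsMax P x = P x × (∀ y → P y → y ≤ x)

Covers : (ℕ → ℕ) → ℕ → ℕ → ℕ → Set
Covers B r j i = 1 ≤ i × i ≤ r × i ≤ j × j ≤ B i

MinCover : (ℕ → ℕ) → ℕ → ℕ → ℕ → Set
MinCover B r j i = Covers B r j i × (∀ k → Covers B r j k → ℓ B i ≤ ℓ B k)

IsA : (ℕ → ℕ) → ℕ → ℕ → ℕ → Set
IsA B r j x = IsMax (MinCover B r j) x

TInv : (ℕ → ℕ) → ℕ → ℕ → ℕ → Set
TInv B r m j = 1 ≤ j × j ≤ r × t B j ≡ m

TUnion : (ℕ → ℕ) → ℕ → ℕ → ℕ → Set
TUnion B r i j = ∃[ m ] (1 ≤ m × m ≤ i × TInv B r m j)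

-- Call k active at position j when 1 ≤ k ≤ r and t_k ≤ j, so the active set at j is
-- ⋃_{m ≤ j} t_m⁻¹. Let a = a(j). An active k > a cannot satisfy ℓ_k ≤ ℓ_a, since then
-- I_k ⊇ [k, B[a]] would be a minimum-length cover of j beyond a; nor ℓ_a < ℓ_k, since then
-- B[a] < t_k ≤ j ≤ B[a]. Conversely a is active: an earlier shorter interval reaching j would
-- beat I_a. So a(j) is the largest active index, and the recurrence holds because the active
-- set at i is the active set at i - 1 together with t_i⁻¹.
module Submission where

open import Defs
open import Data.Nat using (ℕ; zero; suc; _+_; _∸_; _≤_; _<_; _⊔_; z≤n; s≤s; _≤?_; _<?_)
open import Data.Nat.Properties
open import Data.Product using (_×_; _,_; proj₁; proj₂; swap; ∃-syntax)
open import Data.Sum using (inj₁; inj₂)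
open import Data.Empty using (⊥-elim)
open import Data.List using (List; map; filter; foldr; upTo)
open import Data.List.Relation.Unary.All as All using (All)
open import Data.List.Relation.Unary.All.Properties using (all-filter)
open import Data.List.Membership.Propositional using (_∈_)
open import Data.List.Membership.Propositional.Properties
  using (∈-map⁺; ∈-map⁻; ∈-filter⁺; ∈-filter⁻; ∈-upTo⁺; ∈-upTo⁻)
open import Data.List.Properties using (foldr-preservesᵇ; foldr-forcesᵇ)
open import Data.List.Extrema.Nat using (argmin; argmax; argmin-all; argmax-all; f[argmin]≤f[xs]; f[xs]≤f[argmax])
open import Function using (id)
open import Level using (0ℓ)
open import Relation.Binary.PropositionalEquality using (_≡_; refl; sym; subst)
open import Relation.Nullary using (¬_; yes; no)
open import Relation.Nullary.Decidable using (_×-dec_)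
open import Relation.Unary using (Pred; Decidable; _∪_; _≐_)

private
  variable
    P Q : Pred ℕ 0ℓ
    x y w : ℕ

IsMax-resp-≐ : P ≐ Q → IsMax P x → IsMax Q x
IsMax-resp-≐ (P⊆Q , Q⊆P) (Px , x-max) = P⊆Q Px , λ y Qy → x-max y (Q⊆P Qy)

IsMax-∪-∅ : IsMax (P ∪ Q) x → IsMax P y → (∀ k → ¬ Q k) → x ≡ y
IsMax-∪-∅ {P = P} {Q = Q} {x = x} {y = y} (P∪Qx , x-max) (Py , y-max) Q-empty =
  ≤-antisym (y-max x (from-P P∪Qx)) (x-max y (inj₁ Py))
  where
  from-P : ∀ {k} → (P ∪ Q) k → P k
  from-P (inj₁ Pk) = Pk
  from-P (inj₂ Qk) = ⊥-elim (Q-empty _ Qk)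

IsMax-∪ : IsMax (P ∪ Q) x → IsMax P y → IsMax Q w → x ≡ y ⊔ w
IsMax-∪ {P = P} {Q = Q} {y = y} {w = w} (P∪Qx , x-max) (Py , y-max) (Qw , w-max) =
  ≤-antisym (bound P∪Qx) (⊔-lub (x-max y (inj₁ Py)) (x-max w (inj₂ Qw)))
  where
  bound : ∀ {k} → (P ∪ Q) k → k ≤ y ⊔ w
  bound (inj₁ Pk) = ≤-trans (y-max _ Pk) (m≤m⊔n y w)
  bound (inj₂ Qk) = ≤-trans (w-max _ Qk) (m≤n⊔m y w)

module BoundedSearch (P? : Decidable P) (n : ℕ) (P⇒≤n : ∀ {k} → P k → k ≤ n) where

  private
    candidates : List ℕ
    candidates = filter P? (upTo (suc n))

    ∈-candidates : ∀ {k} → P k → k ∈ candidates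
    ∈-candidates Pk = ∈-filter⁺ P? (∈-upTo⁺ (s≤s (P⇒≤n Pk))) Pk

  argmin-exists : (f : ℕ → ℕ) → P x → ∃[ k ] (P k × (∀ y → P y → f k ≤ f y))
  argmin-exists {x} f Px =
    argmin f x candidates , argmin-all f Px (all-filter P? (upTo (suc n))) ,
    λ y Py → All.lookup (f[argmin]≤f[xs] {f = f} x candidates) (∈-candidates Py)

  max-exists : P x → ∃[ m ] IsMax P m
  max-exists {x} Px =
    argmax id x candidates , argmax-all id Px (all-filter P? (upTo (suc n))) ,
    λ y Py → All.lookup (f[xs]≤f[argmax] {f = id} x candidates) (∈-candidates Py)

≤-foldr-⊔ : ∀ {xs k} → k ∈ xs → k ≤ foldr _⊔_ 0 xs
≤-foldr-⊔ {xs} = All.lookup (foldr-forcesᵇ {P = _≤ foldr _⊔_ 0 xs} {f = _⊔_}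
  (λ m n m⊔n≤ → m⊔n≤o⇒m≤o m n m⊔n≤ , m⊔n≤o⇒n≤o m n m⊔n≤) 0 xs ≤-refl)

foldr-⊔-≤ : ∀ {xs j} → (∀ {k} → k ∈ xs → k ≤ j) → foldr _⊔_ 0 xs ≤ j
foldr-⊔-≤ bound = foldr-preservesᵇ ⊔-lub z≤n (All.tabulate bound)

∈-below⁺ : ∀ {h k} → 1 ≤ h → h < k → h ∈ below k
∈-below⁺ {suc _} {suc _} _ (s≤s h<k) = ∈-map⁺ suc (∈-upTo⁺ h<k)

∈-below⁻ : ∀ {h k} → h ∈ below k → 1 ≤ h × h < k
∈-below⁻ {k = k} h∈ with ∈-map⁻ suc h∈
∈-below⁻ {k = zero}  _ | _ , h′∈ , refl with () ← ∈-upTo⁻ h′∈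
∈-below⁻ {k = suc _} _ | _ , h′∈ , refl = s≤s z≤n , s≤s (∈-upTo⁻ h′∈)

module _ (B : ℕ → ℕ) where

  ≤t : ∀ k → k ≤ t B k
  ≤t k = m≤m⊔n k _

  B+1≤t : ∀ {h k} → 1 ≤ h → h < k → ℓ B h < ℓ B k → B h + 1 ≤ t B k
  B+1≤t {h} {k} 1≤h h<k shorter = ≤-trans (≤-foldr-⊔ (∈-map⁺ (λ h → B h + 1) h-counted)) (m≤n⊔m k _)
    where
    h-counted : h ∈ filter (λ h → ℓ B h <? ℓ B k) (below k)
    h-counted = ∈-filter⁺ (λ h → ℓ B h <? ℓ B k) (∈-below⁺ 1≤h h<k) shorter

  t-lub : ∀ {k j} → k ≤ j → (∀ h → 1 ≤ h → h < k → ℓ B h < ℓ B k → B h + 1 ≤ j) → t B k ≤ j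
  t-lub {k} k≤j bound = ⊔-lub k≤j (foldr-⊔-≤ bounded)
    where
    bounded : ∀ {v} → v ∈ map (λ h → B h + 1) (filter (λ h → ℓ B h <? ℓ B k) (below k)) → v ≤ _
    bounded v∈ with ∈-map⁻ (λ h → B h + 1) v∈
    ... | h , h∈ , refl with ∈-filter⁻ (λ h → ℓ B h <? ℓ B k) h∈
    ...   | h∈below , shorter with ∈-below⁻ h∈below
    ...     | 1≤h , h<k = bound h 1≤h h<k shorter

module _ (r : ℕ) (B : ℕ → ℕ) where

  Active : ℕ → Pred ℕ 0ℓ
  Active j k = 1 ≤ k × k ≤ r × t B k ≤ j

  TUnion≐Active : ∀ j → TUnion B r j ≐ Active j
  TUnion≐Active j =
    (λ { (m , _ , m≤j , 1≤k , k≤r , tk≡m) → 1≤k , k≤r , subst (_≤ j) (sym tk≡m) m≤j })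
    , λ { {k} (1≤k , k≤r , tk≤j) → t B k , ≤-trans 1≤k (≤t B k) , tk≤j , 1≤k , k≤r , refl }

  Active-suc : ∀ j → Active (suc j) ≐ Active j ∪ TInv B r (suc j)
  Active-suc j = split , merge
    where
    split : ∀ {k} → Active (suc j) k → (Active j ∪ TInv B r (suc j)) k
    split (1≤k , k≤r , tk≤1+j) with m≤n⇒m<n∨m≡n tk≤1+j
    ... | inj₁ (s≤s tk≤j) = inj₁ (1≤k , k≤r , tk≤j)
    ... | inj₂ tk≡1+j     = inj₂ (1≤k , k≤r , tk≡1+j)
    merge : ∀ {k} → (Active j ∪ TInv B r (suc j)) k → Active (suc j) k
    merge (inj₁ (1≤k , k≤r , tk≤j))    = 1≤k , k≤r , m≤n⇒m≤1+n tk≤j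
    merge (inj₂ (1≤k , k≤r , tk≡1+j)) = 1≤k , k≤r , ≤-reflexive tk≡1+j

  module _ (mono : ∀ i j → 1 ≤ i → i ≤ j → j ≤ r → B i ≤ B j) where

    minCover-active : ∀ {j a} → MinCover B r j a → Active j a
    minCover-active {j} {a} ((1≤a , a≤r , a≤j , _) , a-min) =
      1≤a , a≤r , t-lub B a≤j ends-before-j
      where
      ends-before-j : ∀ h → 1 ≤ h → h < a → ℓ B h < ℓ B a → B h + 1 ≤ j
      ends-before-j h 1≤h h<a shorter with j ≤? B h
      ... | yes j≤Bh = ⊥-elim (<⇒≱ shorter (a-min h h-covers))
        where
        h-covers : Covers B r j h
        h-covers = 1≤h , ≤-trans (<⇒≤ h<a) a≤r , ≤-trans (<⇒≤ h<a) a≤j , j≤Bh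
      ... | no j≰Bh  = subst (_≤ j) (+-comm 1 (B h)) (≰⇒> j≰Bh)

    active≤a : ∀ {j a} → IsA B r j a → ∀ k → Active j k → k ≤ a
    active≤a {j} {a} (((1≤a , a≤r , _ , j≤Ba) , a-min) , a-max) k (1≤k , k≤r , tk≤j) with k ≤? a
    ... | yes k≤a = k≤a
    ... | no k≰a with ℓ B k ≤? ℓ B a
    ...   | yes k-no-longer =
            ⊥-elim (k≰a (a-max k (k-covers , λ i i-covers → ≤-trans k-no-longer (a-min i i-covers))))
      where
      k-covers : Covers B r j k
      k-covers = 1≤k , k≤r , ≤-trans (≤t B k) tk≤j
               , ≤-trans j≤Ba (mono a k 1≤a (<⇒≤ (≰⇒> k≰a)) k≤r)
    ...   | no k-longer = ⊥-elim (1+n≰n (subst (_≤ B a) (+-comm (B a) 1)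
              (≤-trans (≤-trans (B+1≤t B 1≤a (≰⇒> k≰a) (≰⇒> k-longer)) tk≤j) j≤Ba)))

    IsA⇒IsMax-Active : ∀ {j a} → IsA B r j a → IsMax (Active j) a
    IsA⇒IsMax-Active isA = minCover-active (proj₁ isA) , active≤a isA

  module _ (z : ℕ) (1≤r : 1 ≤ r) (ge : ∀ i → 1 ≤ i → i ≤ r → i ≤ B i) (Br≡z : B r ≡ z) where

    covers? : ∀ j → Decidable (Covers B r j)
    covers? j k = (1 ≤? k) ×-dec ((k ≤? r) ×-dec ((k ≤? j) ×-dec (j ≤? B k)))

    some-cover : ∀ {j} → 1 ≤ j → j ≤ z → ∃[ k ] Covers B r j k
    some-cover {j} 1≤j j≤z with j ≤? r
    ... | yes j≤r = j , 1≤j , j≤r , ≤-refl , ge j 1≤j j≤r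
    ... | no j≰r  = r , 1≤r , ≤-refl , <⇒≤ (≰⇒> j≰r) , subst (j ≤_) (sym Br≡z) j≤z

    a-exists : ∀ {j} → 1 ≤ j → j ≤ z → ∃[ a ] IsA B r j a
    a-exists {j} 1≤j j≤z with some-cover 1≤j j≤z
    ... | _ , c-covers with BoundedSearch.argmin-exists (covers? j) r (λ c → proj₁ (proj₂ c)) (ℓ B) c-covers
    ...   | k₀ , k₀-covers , k₀-min
      with BoundedSearch.max-exists (λ k → covers? j k ×-dec (ℓ B k ≤? ℓ B k₀)) r
             (λ c → proj₁ (proj₂ (proj₁ c))) (k₀-covers , ≤-refl)
    ...     | a , ((a-covers , a≤k₀) , a-max) =
              a , (a-covers , λ k k-covers → ≤-trans a≤k₀ (k₀-min k k-covers))
                , λ k (k-covers , k-min) → a-max k (k-covers , k-min k₀ k₀-covers)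

lemma8 : (r z : ℕ) → (B : ℕ → ℕ) → 1 ≤ r → r ≤ z
    → (∀ i j → 1 ≤ i → i ≤ j → j ≤ r → B i ≤ B j)
    → (∀ i → 1 ≤ i → i ≤ r → i ≤ B i)
    → B r ≡ z
    → (∀ i → 1 ≤ i → i ≤ z → ∃[ x ] (IsA B r i x × IsMax (TUnion B r i) x))
      × (∀ i → 2 ≤ i → i ≤ z → ∀ x y → IsA B r i x → IsA B r (i ∸ 1) y
           → ((∀ j → ¬ TInv B r i j) → x ≡ y)
             × (∀ w → IsMax (TInv B r i) w → x ≡ y ⊔ w))
lemma8 r z B 1≤r _ mono ge Br≡z = a-is-max-of-union , recurrence
  where
  a-is-max-of-union : ∀ i → 1 ≤ i → i ≤ z → ∃[ x ] (IsA B r i x × IsMax (TUnion B r i) x)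
  a-is-max-of-union i 1≤i i≤z with a-exists r B z 1≤r ge Br≡z 1≤i i≤z
  ... | a , isA = a , isA , IsMax-resp-≐ (swap (TUnion≐Active r B i)) (IsA⇒IsMax-Active r B mono isA)

  recurrence : ∀ i → 2 ≤ i → i ≤ z → ∀ x y → IsA B r i x → IsA B r (i ∸ 1) y
           → ((∀ j → ¬ TInv B r i j) → x ≡ y) × (∀ w → IsMax (TInv B r i) w → x ≡ y ⊔ w)
  recurrence (suc j) _ _ x y isA-x isA-y =
    IsMax-∪-∅ x-max y-max , λ w → IsMax-∪ x-max y-max
    where
    x-max : IsMax (Active r B j ∪ TInv B r (suc j)) x
    x-max = IsMax-resp-≐ (Active-suc r B j) (IsA⇒IsMax-Active r B mono isA-x)
    y-max : IsMax (Active r B j) y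
    y-max = IsA⇒IsMax-Active r B mono isA-y
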